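{- Let $\varphi$ be a $\mathrm{D}_\circ$-formula with $\circ\in\{\sqsubset,\dot\sqsubset\}$, and let $\mathcal{G}=(\mathbb{P}_\mathbb{S},\mathcal{L})$ be a compass $\varphi$-structure. For all points $(x',y'),(x,y)\in\mathbb{P}_\mathbb{S}$ with $(x',y')\circ(x,y)$, it holds that $\mathcal{R}eq_D(\mathcal{L}(x',y'))\subseteq\mathcal{R}eq_D(\mathcal{L}(x,y))$ and $\mathcal{O}bs_D(\mathcal{L}(x',y'))\subseteq\mathcal{R}eq_D(\mathcal{L}(x,y))$.
   Context: Formulas: $\varphi ::= p\mid\neg\varphi\mid\varphi\vee\varphi\mid\langle D\rangle\varphi$; $[D]\psi:=\neg\langle D\rangle\neg\psi$. $\mathrm{CL}(\varphi)$: subformulas and their negations, identifying $\neg\neg\psi$ with $\psi$ and $\neg\langle D\rangle\psi$ with $[D]\neg\psi$. A $\varphi$-atom is $A\subseteq\mathrm{CL}(\varphi)$ with $\psi\in A$ iff $\neg\psi\notin A$, and $\psi_1\vee\psi_2\in A$ iff $\psi_1\in A$ or $\psi_2\in A$. $\mathcal{R}eq_D(A)=\{\psi:\langle D\rangle\psi\in A\}$, $\mathrm{REQ}_\varphi=\{\psi:\langle D\rangle\psi\in\mathrm{CL}(\varphi)\}$, $\mathcal{O}bs_D(A)=A\cap\mathrm{REQ}_\varphi$. $A\,D_\varphi\,A'$ iff for every $[D]\psi\in A$, $\psi\in A'$ and $[D]\psi\in A'$. For a finite linear order $\mathbb{S}=(S,<)$, $\mathbb{P}_\mathbb{S}=\{(x,y):x,y\in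 S,x\le y\}$; $(x',y')\sqsubset(x,y)$ iff $x\le x'$, $y'\le y$, $(x',y')\ne(x,y)$; $(x',y')\,\dot\sqsubset\,(x,y)$ iff $x<x'$ and $y'<y$. A compass $\varphi$-structure is $(\mathbb{P}_\mathbb{S},\mathcal{L})$ with $\mathcal{L}$ mapping points to $\varphi$-atoms such that $(x',y')\circ(x,y)$ implies $\mathcal{L}(x,y)\,D_\varphi\,\mathcal{L}(x',y')$. -}

module Defs where

open import Data.Nat using (ℕ)
open import Data.Bool using (Bool; true; false)
open import Data.Fin using (Fin; _≤_; _<_)
open import Data.Product using (Σ; _×_; _,_)
open import Data.Sum using (_⊎_)
open import Relation.Nullary using () renaming (¬_ to ¬')
open import Relation.Binary.PropositionalEquality using (_≡_; _≢_)

data Formula : Set where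
  var  : ℕ → Formula
  ¬_   : Formula → Formula
  _∨_  : Formula → Formula → Formula
  ⟨D⟩_ : Formula → Formula

negN : Formula → Formula
negN (¬ ψ) = ψ
negN ψ     = ¬ ψ

-- Normal form: formulas are taken modulo ¬¬ψ = ψ (everywhere),
-- which also realises the identification ¬⟨D⟩ψ = [D]¬ψ.
nf : Formula → Formula
nf (var p)  = var p
nf (¬ ψ)    = negN (nf ψ)
nf (ψ ∨ χ)  = nf ψ ∨ nf χ
nf (⟨D⟩ ψ)  = ⟨D⟩ nf ψ

NF : Formula → Set
NF ψ = nf ψ ≡ ψ

[D]_ : Formula → Formula
[D] ψ = ¬ (⟨D⟩ negN ψ)

data Sub : Formula → Formula → Set where
  sub-refl : ∀ {ψ} → Sub ψ ψ
  sub-¬    : ∀ {ψ χ} → Sub ψ χ → Sub ψ (¬ χ)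
  sub-∨ˡ   : ∀ {ψ χ₁ χ₂} → Sub ψ χ₁ → Sub ψ (χ₁ ∨ χ₂)
  sub-∨ʳ   : ∀ {ψ χ₁ χ₂} → Sub ψ χ₂ → Sub ψ (χ₁ ∨ χ₂)
  sub-D    : ∀ {ψ χ} → Sub ψ χ → Sub ψ (⟨D⟩ χ)

CL : Formula → Formula → Set
CL φ ψ = Σ Formula (λ χ → Sub χ φ × ((ψ ≡ nf χ) ⊎ (ψ ≡ nf (¬ χ))))

FSet : Set
FSet = Formula → Bool

_∈_ : Formula → FSet → Set
ψ ∈ A = A ψ ≡ true

record IsAtom (φ : Formula) (A : FSet) : Set where
  field
    ⊆CL   : ∀ ψ → ψ ∈ A → CL φ ψ
    neg   : ∀ ψ → CL φ ψ → (ψ ∈ A → ¬' (negN ψ ∈ A)) × (¬' (negN ψ ∈ A) → ψ ∈ A)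
    disj  : ∀ ψ₁ ψ₂ → CL φ (ψ₁ ∨ ψ₂) →
              ((ψ₁ ∨ ψ₂) ∈ A → ψ₁ ∈ A ⊎ ψ₂ ∈ A) × (ψ₁ ∈ A ⊎ ψ₂ ∈ A → (ψ₁ ∨ ψ₂) ∈ A)

Req : FSet → Formula → Set
Req A ψ = (⟨D⟩ ψ) ∈ A

REQ : Formula → Formula → Set
REQ φ ψ = CL φ (⟨D⟩ ψ)

Obs : Formula → FSet → Formula → Set
Obs φ A ψ = ψ ∈ A × REQ φ ψ

_⊆_ : (Formula → Set) → (Formula → Set) → Set
P ⊆ Q = ∀ ψ → P ψ → Q ψ

Drel : Formula → FSet → FSet → Set
Drel φ A A' = ∀ ψ → NF ψ → ([D] ψ) ∈ A → ψ ∈ A' × ([D] ψ) ∈ A'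

data Circ : Set where
  ⊏ ⊏̇ : Circ

Rel : Circ → ∀ {n} → Fin n → Fin n → Fin n → Fin n → Set
Rel ⊏ x' y' x y = x ≤ x' × y' ≤ y × ¬' ((x' ≡ x) × (y' ≡ y))
Rel ⊏̇ x' y' x y = x < x' × y' < y

-- compass φ-structure over S = Fin n w.r.t. ∘ (labels only matter on points x ≤ y)
record CompassStructure (c : Circ) (φ : Formula) (n : ℕ) : Set where
  field
    L      : Fin n → Fin n → FSet
    atom   : ∀ x y → x ≤ y → IsAtom φ (L x y)
    compat : ∀ x' y' x y → x' ≤ y' → x ≤ y → Rel c x' y' x y →
               Drel φ (L x y) (L x' y')

-- If ⟨D⟩ψ ∈ CL(φ) is missing from the outer label L(x,y), then [D]¬ψ is there,
-- and D_φ pushes both ¬ψ and [D]¬ψ down to L(x',y'). The latter excludes ⟨D⟩ψ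
-- and the former excludes ψ from L(x',y'); since membership is Boolean, this
-- contradiction yields ⟨D⟩ψ ∈ L(x,y).
module Submission where

open import Defs
open import Data.Nat using (ℕ)
open import Data.Fin using (_≤_)
open import Data.Product using (_×_; _,_; proj₁; proj₂)
open import Data.Sum using (inj₁; inj₂)
open import Data.Bool.Properties using () renaming (_≟_ to _≟ᵇ_)
open import Relation.Binary.PropositionalEquality using (_≡_; refl; sym; trans; cong; subst)
open import Relation.Nullary using () renaming (¬_ to ¬')
open import Relation.Nullary.Decidable using (decidable-stable)

-- The image of nf: formulas without double negations.
data Normal : Formula → Set where
  var   : ∀ p → Normal (var p)
  ¬var  : ∀ p → Normal (¬ var p)
  ¬∨    : ∀ {ψ χ} → Normal (ψ ∨ χ) → Normal (¬ (ψ ∨ χ))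
  ¬⟨D⟩  : ∀ {ψ} → Normal (⟨D⟩ ψ) → Normal (¬ ⟨D⟩ ψ)
  _∨_   : ∀ {ψ χ} → Normal ψ → Normal χ → Normal (ψ ∨ χ)
  ⟨D⟩_  : ∀ {ψ} → Normal ψ → Normal (⟨D⟩ ψ)

negN-normal : ∀ {ψ} → Normal ψ → Normal (negN ψ)
negN-normal (var p)   = ¬var p
negN-normal (¬var p)  = var p
negN-normal (¬∨ n)    = n
negN-normal (¬⟨D⟩ n)  = n
negN-normal (n ∨ m)   = ¬∨ (n ∨ m)
negN-normal (⟨D⟩ n)   = ¬⟨D⟩ (⟨D⟩ n)

nf-normal : ∀ ψ → Normal (nf ψ)
nf-normal (var p)  = var p
nf-normal (¬ ψ)    = negN-normal (nf-normal ψ)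
nf-normal (ψ ∨ χ)  = nf-normal ψ ∨ nf-normal χ
nf-normal (⟨D⟩ ψ)  = ⟨D⟩ nf-normal ψ

normal⇒NF : ∀ {ψ} → Normal ψ → NF ψ
normal⇒NF (var p)             = refl
normal⇒NF (¬var p)            = refl
normal⇒NF (¬∨ n)   rewrite normal⇒NF n = refl
normal⇒NF (¬⟨D⟩ n) rewrite normal⇒NF n = refl
normal⇒NF (n ∨ m)  rewrite normal⇒NF n | normal⇒NF m = refl
normal⇒NF (⟨D⟩ n)  rewrite normal⇒NF n = refl

negN-involutive : ∀ {ψ} → Normal ψ → negN (negN ψ) ≡ ψ
negN-involutive (var p)  = refl
negN-involutive (¬var p) = refl
negN-involutive (¬∨ n)   = refl
negN-involutive (¬⟨D⟩ n) = refl
negN-involutive (n ∨ m)  = refl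
negN-involutive (⟨D⟩ n)  = refl

[D]negN≡¬⟨D⟩ : ∀ {ψ} → Normal ψ → [D] negN ψ ≡ ¬ ⟨D⟩ ψ
[D]negN≡¬⟨D⟩ n = cong (λ χ → ¬ ⟨D⟩ χ) (negN-involutive n)

CL-normal : ∀ {φ ψ} → CL φ ψ → Normal ψ
CL-normal (χ , _ , inj₁ refl) = nf-normal χ
CL-normal (χ , _ , inj₂ refl) = nf-normal (¬ χ)

CL-negN : ∀ {φ ψ} → CL φ ψ → CL φ (negN ψ)
CL-negN (χ , s , inj₁ e) = χ , s , inj₂ (cong negN e)
CL-negN (χ , s , inj₂ e) = χ , s , inj₁ (trans (cong negN e) (negN-involutive (nf-normal χ)))

∈-stable : ∀ {ψ} (A : FSet) → ¬' (¬' (ψ ∈ A)) → ψ ∈ A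
∈-stable {ψ} A = decidable-stable (A ψ ≟ᵇ _)

module _ {φ : Formula} {A : FSet} (atom : IsAtom φ A) where
  open IsAtom atom

  ∈⇒negN∉ : ∀ {ψ} → ψ ∈ A → ¬' (negN ψ ∈ A)
  ∈⇒negN∉ {ψ} ψ∈A = proj₁ (neg ψ (⊆CL ψ ψ∈A)) ψ∈A

  ∉⇒negN∈ : ∀ {ψ} → CL φ ψ → ¬' (ψ ∈ A) → negN ψ ∈ A
  ∉⇒negN∈ {ψ} cl ψ∉A =
    proj₂ (neg (negN ψ) (CL-negN cl))
          (subst (λ χ → ¬' (χ ∈ A)) (sym (negN-involutive (CL-normal cl))) ψ∉A)

  Drel-⟨D⟩∉ : ∀ {A' ψ} → Drel φ A A' → CL φ (⟨D⟩ ψ) → ¬' ((⟨D⟩ ψ) ∈ A) →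
              negN ψ ∈ A' × (¬ ⟨D⟩ ψ) ∈ A'
  Drel-⟨D⟩∉ {A'} {ψ} AD cl ⟨D⟩ψ∉A with CL-normal cl
  ... | ⟨D⟩ n =
    let [D]¬ψ∈A = subst (_∈ A) (sym ([D]negN≡¬⟨D⟩ n)) (∉⇒negN∈ cl ⟨D⟩ψ∉A)
        ¬ψ∈A' , [D]¬ψ∈A' = AD (negN ψ) (normal⇒NF (negN-normal n)) [D]¬ψ∈A
    in ¬ψ∈A' , subst (_∈ A') ([D]negN≡¬⟨D⟩ n) [D]¬ψ∈A'

module _ {φ : Formula} {A A' : FSet} (atom : IsAtom φ A) (atom' : IsAtom φ A')
         (AD : Drel φ A A') where

  Drel⇒Req⊆ : Req A' ⊆ Req A
  Drel⇒Req⊆ ψ ⟨D⟩ψ∈A' = ∈-stable A λ ⟨D⟩ψ∉A →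
    ∈⇒negN∉ atom' ⟨D⟩ψ∈A'
      (proj₂ (Drel-⟨D⟩∉ atom AD (IsAtom.⊆CL atom' _ ⟨D⟩ψ∈A') ⟨D⟩ψ∉A))

  Drel⇒Obs⊆Req : Obs φ A' ⊆ Req A
  Drel⇒Obs⊆Req ψ (ψ∈A' , cl) = ∈-stable A λ ⟨D⟩ψ∉A →
    ∈⇒negN∉ atom' ψ∈A' (proj₁ (Drel-⟨D⟩∉ atom AD cl ⟨D⟩ψ∉A))

lemma2p7 : (c : Circ) (φ : Formula) (n : ℕ) (G : CompassStructure c φ n) →
    ∀ x' y' x y → x' ≤ y' → x ≤ y → Rel c x' y' x y →
      (Req (CompassStructure.L G x' y') ⊆ Req (CompassStructure.L G x y)) ×
      (Obs φ (CompassStructure.L G x' y') ⊆ Req (CompassStructure.L G x y))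
lemma2p7 c φ n G x' y' x y x'≤y' x≤y r =
  Drel⇒Req⊆ outer inner D , Drel⇒Obs⊆Req outer inner D
  where
  open CompassStructure G
  outer = atom x y x≤y
  inner = atom x' y' x'≤y'
  D = compat x' y' x y x'≤y' x≤y r
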